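{- For every integer $n\ge 3$, the homogeneous boolean rank of $S_n$ equals the smallest integer $k$ for which the Johnson graph $J(k,\lfloor k/2\rfloor)$ has a factorizing cycle of length $n$.
   Context: Let $n \ge 3$. $S_n$ denotes the support pattern of the slack matrix of a convex $n$-gon: the $n\times n$ $0/1$ matrix whose $(i,j)$ entry is $0$ if $i \equiv j$ or $i \equiv j+1 \pmod n$ and $1$ otherwise (indices in $\{1,\dots,n\}$). A homogeneous boolean factorization of $S_n$ of size $k$ is a pair of $0/1$ matrices $C$ and $D$, each of size $n\times k$, such that every row of $C$ has exactly $\lfloor k/2\rfloor$ ones, every row of $D$ has exactly $\lceil k/2\rceil-1$ ones, and $CD^T$ has the same set of nonzero entries as $S_n$. The homogeneous boolean rank of $S_n$ is the smallest $k$ for which such a factorization exists. The Johnson graph $J(k,m)$ has as vertices the $m$-element subsets of $\{1,\dots,k\}$, two vertices being adjacent iff they share $m-1$ elements. Color each edge $\{S,T\}$ of $J(k,\lfloor k/2\rfloor)$ by the set $\{1,\dots,k\}\setminus(S\cup T)$. A cycle $(V_1,\dots,V_n,V_1)$ of distinct vertices in $J(k,\lfloor k/2\rfloor)$ is a factorizing cycle if (i) its $n$ edges have pairwise distinct colors (it is rainbow), and (ii) for each edge of the cycle, with color $X$, no edge of $J(k,\lfloor k/2\rfloor)$ of color $X$ is incident to any vertex of the cycle other than the two endpoints of that edge (equivalently, $X\cap V_i\neq\emptyset$ for every cycle vertex $V_i$ that is not an endpoint of that edge). -}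

module Defs where

open import Data.Nat using (ℕ; zero; suc; _∸_; _≥_; _≤_; ⌊_/2⌋; ⌈_/2⌉)
open import Data.Nat.DivMod using (_mod_)
open import Data.Fin using (Fin; toℕ)
open import Data.Fin.Subset using (Subset; ∣_∣; _∩_; _∪_; ∁; Nonempty)
open import Data.Product using (Σ; _×_; ∃)
open import Data.Sum using (_⊎_)
open import Function.Bundles using (_⇔_)
open import Function.Definitions using (Injective)
open import Relation.Binary.PropositionalEquality using (_≡_; _≢_)
open import Relation.Nullary using (¬_)

-- Indices are 0-based (Fin n) instead of 1-based; the pattern is shift-invariant.

next : ∀ {n} → Fin n → Fin n
next {suc m} i = suc (toℕ i) mod (suc m)

SnZero : ∀ {n} → Fin n → Fin n → Set
SnZero i j = i ≡ j ⊎ i ≡ next j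

-- An n×k 0/1 matrix, given by its rows (row i = set of columns holding a 1)
Matrix01 : ℕ → ℕ → Set
Matrix01 n k = Fin n → Subset k

-- (C Dᵀ)ᵢⱼ ≠ 0  iff  some column l has C i l = D j l = 1
ProdNonzero : ∀ {n k} → Matrix01 n k → Matrix01 n k → Fin n → Fin n → Set
ProdNonzero C D i j = Nonempty (C i ∩ D j)

record HomFact (n k : ℕ) : Set where
  field
    C : Matrix01 n k
    D : Matrix01 n k
    rowC : ∀ i → ∣ C i ∣ ≡ ⌊ k /2⌋
    rowD : ∀ i → ∣ D i ∣ ≡ ⌈ k /2⌉ ∸ 1
    support : ∀ i j → ProdNonzero C D i j ⇔ (¬ SnZero i j)

IsVertex : ∀ {k} → ℕ → Subset k → Set
IsVertex m S = ∣ S ∣ ≡ m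

Adj : ∀ {k} → ℕ → Subset k → Subset k → Set
Adj m S T = IsVertex m S × IsVertex m T × S ≢ T × ∣ S ∩ T ∣ ≡ m ∸ 1

colour : ∀ {k} → Subset k → Subset k → Subset k
colour S T = ∁ (S ∪ T)

record FactCycle (n k : ℕ) : Set where
  field
    V : Fin n → Subset k
    distinct : Injective _≡_ _≡_ V
    vertices : ∀ i → IsVertex ⌊ k /2⌋ (V i)
    edges : ∀ i → Adj ⌊ k /2⌋ (V i) (V (next i))
    rainbow : Injective _≡_ _≡_ (λ i → colour (V i) (V (next i)))
    isolating : ∀ i j → j ≢ i → j ≢ next i → ∀ (W : Subset k) →
      Adj ⌊ k /2⌋ (V j) W → colour (V j) W ≢ colour (V i) (V (next i))

IsLeast : (ℕ → Set) → ℕ → Set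
IsLeast P k = P k × (∀ k′ → P k′ → k ≤ k′)

module Submission where

open import Defs
open import Data.Nat using (ℕ; zero; suc; _+_; _∸_; _%_; _≤_; _≥_; _≟_; s≤s; ⌊_/2⌋; ⌈_/2⌉)
open import Data.Nat.Properties
  using ( suc-injective; +-suc; +-comm; +-cancelˡ-≡; +-cancelʳ-≡; m+n∸m≡n
        ; ≤-reflexive; ≤-trans; n≮n; ≤∧≢⇒<; ⌊n/2⌋+⌈n/2⌉≡n)
open import Data.Nat.DivMod using (m<n⇒m%n≡m; n%n≡0)
open import Data.Fin using (Fin; zero; suc; toℕ) renaming (_≟_ to _≟ᶠ_)
open import Data.Fin.Properties using (toℕ-fromℕ<; toℕ-injective; toℕ≤pred[n])
open import Data.Fin.Subset
open import Data.Fin.Subset.Properties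
open import Data.Vec using ([]; _∷_; here; there)
open import Data.Product using (_,_; _×_; ∃-syntax)
open import Data.Sum using (inj₁; inj₂; [_,_]′)
open import Data.Empty using (⊥-elim)
open import Function using (_∘_)
open import Function.Bundles using (_⇔_; mk⇔; Equivalence)
open import Relation.Nullary using (¬_; yes; no; contradiction)
open import Relation.Nullary.Decidable using (_⊎-dec_; decidable-stable)
open import Relation.Binary.PropositionalEquality
import Algebra.Lattice.Properties.BooleanAlgebra as BooleanAlgebraProperties

-- For every size k the two objects determine each other, with V i = C i and D i the colour
-- of the edge V i V (i+1). Given a factorization, the zeros of S_n in column i say that
-- C i and C (i+1) lie in the (⌊k/2⌋+1)-set ∁ (D i); being distinct ⌊k/2⌋-sets they are
-- adjacent and cover it, so D i is the colour of their edge, and the remaining zero pattern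
-- of S_n turns into injectivity, rainbowness and isolation. Conversely, a vertex V i that
-- is not an endpoint of edge j and misses its colour lies inside V j ∪ V (j+1); exchanging
-- one of its elements for the rest of that union gives a neighbour of V i along an edge of
-- the same colour, against isolation.

sucMod : ℕ → ℕ → ℕ
sucMod N a with a ≟ N
... | yes _ = 0
... | no _  = suc a

toℕ-next : ∀ {N} (i : Fin (suc N)) → toℕ (next i) ≡ sucMod N (toℕ i)
toℕ-next {N} i with toℕ i ≟ N
... | yes i≡N = trans (toℕ-fromℕ< _) (trans (cong (λ a → suc a % suc N) i≡N) (n%n≡0 (suc N)))
... | no i≢N  = trans (toℕ-fromℕ< _) (m<n⇒m%n≡m (s≤s (≤∧≢⇒< (toℕ≤pred[n] i) i≢N)))

sucMod-injective : ∀ N {a b} → sucMod N a ≡ sucMod N b → a ≡ b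
sucMod-injective N {a} {b} eq with a ≟ N | b ≟ N | eq
... | yes a≡N | yes b≡N | _   = trans a≡N (sym b≡N)
... | yes _   | no _    | ()
... | no _    | yes _   | ()
... | no _    | no _    | eq′ = suc-injective eq′

sucMod-≢ : ∀ N a → sucMod (suc N) a ≢ a
sucMod-≢ N a with a ≟ suc N
... | yes refl = λ ()
... | no _     = λ ()

sucMod²-≢ : ∀ N a → sucMod (2 + N) (sucMod (2 + N) a) ≢ a
sucMod²-≢ N a with a ≟ 2 + N
... | yes refl = λ ()
... | no _ with suc a ≟ 2 + N
...   | yes 1+a≡2+N = λ { refl → contradiction 1+a≡2+N λ () }
...   | no _        = λ ()

next-injective : ∀ {N} {i j : Fin (suc N)} → next i ≡ next j → i ≡ j
next-injective {N} {i} {j} eq =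
  toℕ-injective (sucMod-injective N (trans (sym (toℕ-next i)) (trans (cong toℕ eq) (toℕ-next j))))

next-≢ : ∀ {N} (i : Fin (2 + N)) → next i ≢ i
next-≢ {N} i eq = sucMod-≢ N (toℕ i) (trans (sym (toℕ-next i)) (cong toℕ eq))

next²-≢ : ∀ {N} (i : Fin (3 + N)) → next (next i) ≢ i
next²-≢ {N} i eq = sucMod²-≢ N (toℕ i) (begin
  sucMod (2 + N) (sucMod (2 + N) (toℕ i)) ≡⟨ cong (sucMod (2 + N)) (toℕ-next i) ⟨
  sucMod (2 + N) (toℕ (next i))           ≡⟨ toℕ-next (next i) ⟨
  toℕ (next (next i))                     ≡⟨ cong toℕ eq ⟩
  toℕ i                                   ∎)
  where open ≡-Reasoning

∣p∪q∣+∣p∩q∣≡∣p∣+∣q∣ : ∀ {k} (p q : Subset k) → ∣ p ∪ q ∣ + ∣ p ∩ q ∣ ≡ ∣ p ∣ + ∣ q ∣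
∣p∪q∣+∣p∩q∣≡∣p∣+∣q∣ []            []            = refl
∣p∪q∣+∣p∩q∣≡∣p∣+∣q∣ (inside ∷ p)  (inside ∷ q)  =
  cong suc (trans (+-suc _ _) (trans (cong suc (∣p∪q∣+∣p∩q∣≡∣p∣+∣q∣ p q)) (sym (+-suc _ _))))
∣p∪q∣+∣p∩q∣≡∣p∣+∣q∣ (inside ∷ p)  (outside ∷ q) = cong suc (∣p∪q∣+∣p∩q∣≡∣p∣+∣q∣ p q)
∣p∪q∣+∣p∩q∣≡∣p∣+∣q∣ (outside ∷ p) (inside ∷ q)  =
  trans (cong suc (∣p∪q∣+∣p∩q∣≡∣p∣+∣q∣ p q)) (sym (+-suc _ _))
∣p∪q∣+∣p∩q∣≡∣p∣+∣q∣ (outside ∷ p) (outside ∷ q) = ∣p∪q∣+∣p∩q∣≡∣p∣+∣q∣ p q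

p⊆q∧∣q∣≤∣p∣⇒p≡q : ∀ {k} {p q : Subset k} → p ⊆ q → ∣ q ∣ ≤ ∣ p ∣ → p ≡ q
p⊆q∧∣q∣≤∣p∣⇒p≡q {p = []}          {[]}          _   _           = refl
p⊆q∧∣q∣≤∣p∣⇒p≡q {p = inside ∷ p}  {inside ∷ q}  p⊆q (s≤s q≤p) =
  cong (inside ∷_) (p⊆q∧∣q∣≤∣p∣⇒p≡q (drop-∷-⊆ p⊆q) q≤p)
p⊆q∧∣q∣≤∣p∣⇒p≡q {p = outside ∷ p} {outside ∷ q} p⊆q q≤p       =
  cong (outside ∷_) (p⊆q∧∣q∣≤∣p∣⇒p≡q (drop-∷-⊆ p⊆q) q≤p)
p⊆q∧∣q∣≤∣p∣⇒p≡q {p = inside ∷ p}  {outside ∷ q} p⊆q _         with p⊆q here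
... | ()
p⊆q∧∣q∣≤∣p∣⇒p≡q {p = outside ∷ p} {inside ∷ q}  p⊆q q≤p       =
  contradiction (≤-trans q≤p (p⊆q⇒∣p∣≤∣q∣ (drop-∷-⊆ p⊆q))) (n≮n _)

suc∣p-x∣≡∣p∣ : ∀ {k} {x : Fin k} {p : Subset k} → x ∈ p → suc ∣ p - x ∣ ≡ ∣ p ∣
suc∣p-x∣≡∣p∣ {x = zero}  {inside ∷ p}  here      = cong (suc ∘ ∣_∣) (p─⊥≡p p)
suc∣p-x∣≡∣p∣ {x = suc x} {inside ∷ p}  (there m) = cong suc (suc∣p-x∣≡∣p∣ m)
suc∣p-x∣≡∣p∣ {x = suc x} {outside ∷ p} (there m) = suc∣p-x∣≡∣p∣ m

∣p∣≡0⇒p≡⊥ : ∀ {k} {p : Subset k} → ∣ p ∣ ≡ 0 → p ≡ ⊥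
∣p∣≡0⇒p≡⊥ {p = []}          _  = refl
∣p∣≡0⇒p≡⊥ {p = outside ∷ p} eq = cong (outside ∷_) (∣p∣≡0⇒p≡⊥ eq)

∣p∣≢0⇒Nonempty : ∀ {k} {p : Subset k} → ∣ p ∣ ≢ 0 → Nonempty p
∣p∣≢0⇒Nonempty {k} {p} ∣p∣≢0 with nonempty? p
... | yes nonempty = nonempty
... | no empty     = contradiction (trans (cong ∣_∣ (Empty-unique empty)) (∣⊥∣≡0 k)) ∣p∣≢0

∁-involutive : ∀ {k} (p : Subset k) → ∁ (∁ p) ≡ p
∁-involutive {k} = BooleanAlgebraProperties.¬-involutive (∪-∩-booleanAlgebra k)

∣∁p∣≡ : ∀ {k a b} (p : Subset k) → a + b ≡ k → ∣ p ∣ ≡ a → ∣ ∁ p ∣ ≡ b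
∣∁p∣≡ {a = a} {b} p a+b≡k ∣p∣≡a = begin
  ∣ ∁ p ∣    ≡⟨ ∣∁p∣≡n∸∣p∣ p ⟩
  _ ∸ ∣ p ∣  ≡⟨ cong₂ _∸_ (sym a+b≡k) ∣p∣≡a ⟩
  a + b ∸ a  ≡⟨ m+n∸m≡n a b ⟩
  b          ∎
  where open ≡-Reasoning

Empty[p∩q]⇒p⊆∁q : ∀ {k} {p q : Subset k} → Empty (p ∩ q) → p ⊆ ∁ q
Empty[p∩q]⇒p⊆∁q empty x∈p = x∉p⇒x∈∁p (λ x∈q → empty (_ , x∈p∩q⁺ (x∈p , x∈q)))

Empty[p∩∁q]⇒p⊆q : ∀ {k} {p q : Subset k} → Empty (p ∩ ∁ q) → p ⊆ q
Empty[p∩∁q]⇒p⊆q empty x∈p = x∉∁p⇒x∈p (λ x∈∁q → empty (_ , x∈p∩q⁺ (x∈p , x∈∁q)))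

colour-disjointˡ : ∀ {k} (S T : Subset k) → Empty (S ∩ colour S T)
colour-disjointˡ S T (x , x∈S∩colour) with x∈p∩q⁻ S (colour S T) x∈S∩colour
... | x∈S , x∈colour = x∈∁p⇒x∉p x∈colour (x∈p∪q⁺ (inj₁ x∈S))

colour-disjointʳ : ∀ {k} (S T : Subset k) → Empty (T ∩ colour S T)
colour-disjointʳ S T (x , x∈T∩colour) with x∈p∩q⁻ T (colour S T) x∈T∩colour
... | x∈T , x∈colour = x∈∁p⇒x∉p x∈colour (x∈p∪q⁺ (inj₂ x∈T))

∣∪∣≡suc⇒∣∩∣≡pred : ∀ {k m} (S T : Subset k) → ∣ S ∣ ≡ m → ∣ T ∣ ≡ m →
                   ∣ S ∪ T ∣ ≡ suc m → ∣ S ∩ T ∣ ≡ m ∸ 1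
∣∪∣≡suc⇒∣∩∣≡pred {m = m} S T ∣S∣≡m ∣T∣≡m ∣S∪T∣≡1+m = cancel m (begin
  suc m + ∣ S ∩ T ∣      ≡⟨ cong (_+ ∣ S ∩ T ∣) ∣S∪T∣≡1+m ⟨
  ∣ S ∪ T ∣ + ∣ S ∩ T ∣  ≡⟨ ∣p∪q∣+∣p∩q∣≡∣p∣+∣q∣ S T ⟩
  ∣ S ∣ + ∣ T ∣          ≡⟨ cong₂ _+_ ∣S∣≡m ∣T∣≡m ⟩
  m + m                  ∎)
  where
  open ≡-Reasoning
  cancel : ∀ m {x} → suc m + x ≡ m + m → x ≡ m ∸ 1
  cancel (suc m) {x} eq = +-cancelˡ-≡ (2 + m) x m (trans eq (+-suc (suc m) m))

adjacent⇒m≢0 : ∀ {k m} {S T : Subset k} → Adj m S T → m ≢ 0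
adjacent⇒m≢0 (∣S∣≡m , ∣T∣≡m , S≢T , _) refl =
  S≢T (trans (∣p∣≡0⇒p≡⊥ ∣S∣≡m) (sym (∣p∣≡0⇒p≡⊥ ∣T∣≡m)))

adjacent⇒∣∪∣≡suc : ∀ {k m} {S T : Subset k} → Adj m S T → ∣ S ∪ T ∣ ≡ suc m
adjacent⇒∣∪∣≡suc {m = zero}  adj = contradiction refl (adjacent⇒m≢0 adj)
adjacent⇒∣∪∣≡suc {m = suc m} {S} {T} (∣S∣≡m , ∣T∣≡m , _ , ∣S∩T∣≡m-1) =
  +-cancelʳ-≡ m ∣ S ∪ T ∣ (2 + m) (begin
    ∣ S ∪ T ∣ + m          ≡⟨ cong (∣ S ∪ T ∣ +_) ∣S∩T∣≡m-1 ⟨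
    ∣ S ∪ T ∣ + ∣ S ∩ T ∣  ≡⟨ ∣p∪q∣+∣p∩q∣≡∣p∣+∣q∣ S T ⟩
    ∣ S ∣ + ∣ T ∣          ≡⟨ cong₂ _+_ ∣S∣≡m ∣T∣≡m ⟩
    suc m + suc m          ≡⟨ +-suc (suc m) m ⟩
    2 + m + m              ∎)
  where open ≡-Reasoning

distinct⊆⇒∪≡ : ∀ {k m} {S T E : Subset k} → S ⊆ E → T ⊆ E → ∣ S ∣ ≡ m → ∣ T ∣ ≡ m →
               ∣ E ∣ ≡ suc m → S ≢ T → S ∪ T ≡ E
distinct⊆⇒∪≡ {m = m} {S} {T} {E} S⊆E T⊆E ∣S∣≡m ∣T∣≡m ∣E∣≡1+m S≢T =
  p⊆q∧∣q∣≤∣p∣⇒p≡q S∪T⊆E (subst (_≤ ∣ S ∪ T ∣) (sym ∣E∣≡1+m) 1+m≤∣S∪T∣)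
  where
  S∪T⊆E : S ∪ T ⊆ E
  S∪T⊆E x∈S∪T = [ S⊆E , T⊆E ]′ (x∈p∪q⁻ S T x∈S∪T)
  1+m≤∣S∪T∣ : suc m ≤ ∣ S ∪ T ∣
  1+m≤∣S∪T∣ = ≤∧≢⇒< (subst (_≤ ∣ S ∪ T ∣) ∣S∣≡m (∣p∣≤∣p∪q∣ S T)) λ m≡∣S∪T∣ →
    S≢T (trans (fills (p⊆p∪q T) ∣S∣≡m m≡∣S∪T∣) (sym (fills (q⊆p∪q S T) ∣T∣≡m m≡∣S∪T∣)))
    where
    fills : ∀ {R} → R ⊆ S ∪ T → ∣ R ∣ ≡ m → m ≡ ∣ S ∪ T ∣ → R ≡ S ∪ T
    fills R⊆ ∣R∣≡m m≡ = p⊆q∧∣q∣≤∣p∣⇒p≡q R⊆ (≤-reflexive (trans (sym m≡) (sym ∣R∣≡m)))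

x∉p-x : ∀ {k} (x : Fin k) (p : Subset k) → x ∉ p - x
x∉p-x zero    (_ ∷ p) ()
x∉p-x (suc x) (_ ∷ p) (there x∈p-x) = x∉p-x x p x∈p-x

exchange-neighbour : ∀ {k m} {S U : Subset k} → S ⊆ U → Nonempty S →
                     ∣ S ∣ ≡ m → ∣ U ∣ ≡ suc m → ∃[ W ] Adj m S W × S ∪ W ≡ U
exchange-neighbour {m = m} {S} {U} S⊆U (y , y∈S) ∣S∣≡m ∣U∣≡1+m =
  U - y , (∣S∣≡m , ∣U-y∣≡m , S≢U-y , ∣S∩[U-y]∣≡m-1) , S∪[U-y]≡U
  where
  ∣U-y∣≡m : ∣ U - y ∣ ≡ m
  ∣U-y∣≡m = suc-injective (trans (suc∣p-x∣≡∣p∣ (S⊆U y∈S)) ∣U∣≡1+m)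

  S≢U-y : S ≢ U - y
  S≢U-y S≡U-y = x∉p-x y U (subst (y ∈_) S≡U-y y∈S)

  U⊆S∪[U-y] : U ⊆ S ∪ (U - y)
  U⊆S∪[U-y] {x} x∈U with x ≟ᶠ y
  ... | yes refl = x∈p∪q⁺ (inj₁ y∈S)
  ... | no x≢y   = x∈p∪q⁺ (inj₂ (x∈p∧x≢y⇒x∈p-y x∈U x≢y))

  S∪[U-y]≡U : S ∪ (U - y) ≡ U
  S∪[U-y]≡U = ⊆-antisym (λ x∈ → [ S⊆U , p─q⊆p U ⁅ y ⁆ ]′ (x∈p∪q⁻ S (U - y) x∈)) U⊆S∪[U-y]

  ∣S∩[U-y]∣≡m-1 : ∣ S ∩ (U - y) ∣ ≡ m ∸ 1
  ∣S∩[U-y]∣≡m-1 =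
    ∣∪∣≡suc⇒∣∩∣≡pred S (U - y) ∣S∣≡m ∣U-y∣≡m (trans (cong ∣_∣ S∪[U-y]≡U) ∣U∣≡1+m)

module FactorizationToCycle {n k : ℕ} (F : HomFact (3 + n) (suc k)) where
  open HomFact F

  zero⇒disjoint : ∀ {i j} → SnZero i j → Empty (C i ∩ D j)
  zero⇒disjoint {i} {j} zero-entry nonempty = Equivalence.to (support i j) nonempty zero-entry

  disjoint⇒zero : ∀ {i j} → Empty (C i ∩ D j) → SnZero i j
  disjoint⇒zero {i} {j} empty =
    decidable-stable ((i ≟ᶠ j) ⊎-dec (i ≟ᶠ next j)) (empty ∘ Equivalence.from (support i j))

  zero-transfer : ∀ {i i′ j j′} → C i ≡ C i′ → D j ≡ D j′ → SnZero i j → SnZero i′ j′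
  zero-transfer Ci≡Ci′ Dj≡Dj′ =
    disjoint⇒zero ∘ subst₂ (λ X Y → Empty (X ∩ Y)) Ci≡Ci′ Dj≡Dj′ ∘ zero⇒disjoint

  C-injective : ∀ {i j} → C i ≡ C j → i ≡ j
  C-injective {i} {j} Ci≡Cj
    with zero-transfer (sym Ci≡Cj) refl (inj₁ refl) | zero-transfer Ci≡Cj refl (inj₁ refl)
  ... | inj₁ i≡j      | _             = i≡j
  ... | inj₂ _        | inj₁ j≡i      = sym j≡i
  ... | inj₂ i≡next-j | inj₂ j≡next-i =
    ⊥-elim (next²-≢ j (trans (cong next (sym i≡next-j)) (sym j≡next-i)))

  D-injective : ∀ {i j} → D i ≡ D j → i ≡ j
  D-injective {i} {j} Di≡Dj
    with zero-transfer refl Di≡Dj (inj₁ refl) | zero-transfer refl Di≡Dj (inj₂ refl)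
  ... | inj₁ i≡j      | _                  = i≡j
  ... | inj₂ _        | inj₂ next-i≡next-j = next-injective next-i≡next-j
  ... | inj₂ i≡next-j | inj₁ next-i≡j      =
    ⊥-elim (next²-≢ j (trans (cong next (sym i≡next-j)) next-i≡j))

  ∣∁D∣≡ : ∀ i → ∣ ∁ (D i) ∣ ≡ suc ⌊ suc k /2⌋
  ∣∁D∣≡ i = ∣∁p∣≡ (D i) (trans (+-suc ⌊ k /2⌋ ⌈ k /2⌉) (cong suc (⌊n/2⌋+⌈n/2⌉≡n k))) (rowD i)

  C∪C≡∁D : ∀ i → C i ∪ C (next i) ≡ ∁ (D i)
  C∪C≡∁D i = distinct⊆⇒∪≡ (C⊆∁D (inj₁ refl)) (C⊆∁D (inj₂ refl)) (rowC i) (rowC (next i))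
                           (∣∁D∣≡ i) (next-≢ i ∘ sym ∘ C-injective)
    where
    C⊆∁D : ∀ {i′} → SnZero i′ i → C i′ ⊆ ∁ (D i)
    C⊆∁D = Empty[p∩q]⇒p⊆∁q ∘ zero⇒disjoint

  colour≡D : ∀ i → colour (C i) (C (next i)) ≡ D i
  colour≡D i = trans (cong ∁ (C∪C≡∁D i)) (∁-involutive (D i))

  edge : ∀ i → Adj ⌊ suc k /2⌋ (C i) (C (next i))
  edge i = rowC i , rowC (next i) , next-≢ i ∘ sym ∘ C-injective
         , ∣∪∣≡suc⇒∣∩∣≡pred (C i) (C (next i)) (rowC i) (rowC (next i))
                              (trans (cong ∣_∣ (C∪C≡∁D i)) (∣∁D∣≡ i))

  isolating : ∀ i j → j ≢ i → j ≢ next i → ∀ (W : Subset (suc k)) →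
              Adj ⌊ suc k /2⌋ (C j) W → colour (C j) W ≢ colour (C i) (C (next i))
  isolating i j j≢i j≢next-i W _ colour≡ = [ j≢i , j≢next-i ]′ (disjoint⇒zero
    (subst (λ X → Empty (C j ∩ X)) (trans colour≡ (colour≡D i)) (colour-disjointˡ (C j) W)))

  factCycle : FactCycle (3 + n) (suc k)
  factCycle = record
    { V         = C
    ; distinct  = C-injective
    ; vertices  = rowC
    ; edges     = edge
    ; rainbow   = λ {i} {j} colour≡ →
                    D-injective (trans (sym (colour≡D i)) (trans colour≡ (colour≡D j)))
    ; isolating = isolating
    }

module CycleToFactorization {n k : ℕ} (Q : FactCycle n (suc k)) where
  open FactCycle Q

  D : Matrix01 n (suc k)
  D i = colour (V i) (V (next i))

  ∣D∣≡ : ∀ i → ∣ D i ∣ ≡ ⌈ suc k /2⌉ ∸ 1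
  ∣D∣≡ i = ∣∁p∣≡ (V i ∪ V (next i))
                 (cong suc (trans (+-comm ⌈ k /2⌉ ⌊ k /2⌋) (⌊n/2⌋+⌈n/2⌉≡n k)))
                 (adjacent⇒∣∪∣≡suc (edges i))

  zero⇒disjoint : ∀ {i j} → SnZero i j → Empty (V i ∩ D j)
  zero⇒disjoint {j = j} (inj₁ refl) = colour-disjointˡ (V j) (V (next j))
  zero⇒disjoint {j = j} (inj₂ refl) = colour-disjointʳ (V j) (V (next j))

  nonzero⇒intersecting : ∀ {i j} → ¬ SnZero i j → Nonempty (V i ∩ D j)
  nonzero⇒intersecting {i} {j} nonzero = decidable-stable (nonempty? (V i ∩ D j)) λ empty →
    let W , Vi~W , Vi∪W≡edge = exchange-neighbour (Empty[p∩∁q]⇒p⊆q empty) Vi-nonempty (vertices i)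
                                                   (adjacent⇒∣∪∣≡suc (edges j))
    in isolating j i (nonzero ∘ inj₁) (nonzero ∘ inj₂) W Vi~W (cong ∁ Vi∪W≡edge)
    where
    Vi-nonempty : Nonempty (V i)
    Vi-nonempty = ∣p∣≢0⇒Nonempty (adjacent⇒m≢0 (edges i) ∘ trans (sym (vertices i)))

  homFact : HomFact n (suc k)
  homFact = record
    { C       = V
    ; D       = D
    ; rowC    = vertices
    ; rowD    = ∣D∣≡
    ; support = λ i j → mk⇔ (λ nonempty zero-entry → zero⇒disjoint zero-entry nonempty)
                            nonzero⇒intersecting
    }

¬HomFact[size0] : ∀ {n} → ¬ HomFact (3 + n) 0
¬HomFact[size0] F
  with Equivalence.from (HomFact.support F (next (next zero)) zero)
                        [ next²-≢ zero , next-≢ zero ∘ next-injective ]′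
... | () , _

¬FactCycle[size0] : ∀ {n} → ¬ FactCycle (suc n) 0
¬FactCycle[size0] Q = adjacent⇒m≢0 (FactCycle.edges Q zero) refl

homFact⇔factCycle : ∀ n k → HomFact (3 + n) k ⇔ FactCycle (3 + n) k
homFact⇔factCycle n zero    = mk⇔ (⊥-elim ∘ ¬HomFact[size0]) (⊥-elim ∘ ¬FactCycle[size0])
homFact⇔factCycle n (suc k) = mk⇔ FactorizationToCycle.factCycle CycleToFactorization.homFact

IsLeast-cong : ∀ {P Q : ℕ → Set} → (∀ k → P k ⇔ Q k) → ∀ k → IsLeast P k ⇔ IsLeast Q k
IsLeast-cong P⇔Q k = mk⇔
  (λ (Pk , least) → Equivalence.to (P⇔Q k) Pk , λ k′ → least k′ ∘ Equivalence.from (P⇔Q k′))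
  (λ (Qk , least) → Equivalence.from (P⇔Q k) Qk , λ k′ → least k′ ∘ Equivalence.to (P⇔Q k′))

mainTheorem5 : ∀ (n : ℕ) → n ≥ 3 → ∀ (k : ℕ) →
    IsLeast (HomFact n) k ⇔ IsLeast (FactCycle n) k
mainTheorem5 (suc (suc (suc n))) (s≤s (s≤s (s≤s _))) = IsLeast-cong (homFact⇔factCycle n)
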